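{- Let $A$ be a $V\times V$-matrix over $GF(4)$ (with $V$ finite) that is $\mathrm{inv}$-symmetric, i.e. $\mathrm{inv}(-A^T)=A$. Then $A$ is principally unimodular, i.e. $\det(A[Y])\in\{0,1,-1\}$ for all $Y\subseteq V$.
   Context: $\mathrm{inv}$ denotes the unique nontrivial field automorphism of $GF(4)$, given by $x\mapsto x^2$ (equivalently $x\mapsto x^{ -1}$ for $x\neq 0$), applied entrywise to matrices. For $Y\subseteq V$, $A[Y]$ is the principal submatrix with rows and columns indexed by $Y$; the determinant of the empty matrix is $1$. Note $-1=1$ in $GF(4)$. -}

module Defs where

open import Data.Nat using (ℕ; zero; suc)
open import Data.Fin using (Fin; zero; suc; punchIn)
open import Data.Fin.Subset using (Subset; inside; outside)
open import Data.Vec using (Vec; []; _∷_; _∷ʳ_)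
open import Data.List using (List; []; _∷_; length; map)
open import Data.List as List using ()
open import Relation.Binary.PropositionalEquality using (_≡_)

-- The field GF(4) = {0, 1, ω, ω²} with ω² = ω + 1.
data GF4 : Set where
  O I ω ω² : GF4

infixl 6 _+_
infixl 7 _*_

_+_ : GF4 → GF4 → GF4
O  + y  = y
x  + O  = x
I  + I  = O
I  + ω  = ω²
I  + ω² = ω
ω  + I  = ω²
ω  + ω  = O
ω  + ω² = I
ω² + I  = ω
ω² + ω  = I
ω² + ω² = O

_*_ : GF4 → GF4 → GF4
O  * _  = O
_  * O  = O
I  * y  = y
x  * I  = x
ω  * ω  = ω²
ω  * ω² = I
ω² * ω  = I
ω² * ω² = ω

-- additive inverse (characteristic 2, so this is the identity)
-_ : GF4 → GF4
- x = x

-- the nontrivial field automorphism x ↦ x²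
inv : GF4 → GF4
inv O  = O
inv I  = I
inv ω  = ω²
inv ω² = ω

-- matrices indexed by a finite set V = Fin n
Matrix : ℕ → ℕ → Set
Matrix m n = Fin m → Fin n → GF4

transpose : ∀ {m n} → Matrix m n → Matrix n m
transpose A i j = A j i

negM : ∀ {m n} → Matrix m n → Matrix m n
negM A i j = - A i j

invM : ∀ {m n} → Matrix m n → Matrix m n
invM A i j = inv (A i j)

InvSymmetric : ∀ {n} → Matrix n n → Set
InvSymmetric A = ∀ i j → invM (negM (transpose A)) i j ≡ A i j

sumF : ∀ k → (Fin k → GF4) → GF4
sumF zero    f = O
sumF (suc k) f = f zero + sumF k (λ j → f (suc j))

signed : ℕ → GF4 → GF4
signed zero    x = x
signed (suc j) x = - signed j x

det : ∀ k → Matrix k k → GF4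
det zero    M = I
det (suc k) M = sumF (suc k) (λ j →
  signed (Data.Fin.toℕ j) (M zero j * det k (λ r c → M (suc r) (punchIn j c))))

elems : ∀ {n} → Subset n → List (Fin n)
elems []            = []
elems (outside ∷ p) = map suc (elems p)
elems (inside ∷ p)  = zero ∷ map suc (elems p)

principalSub : ∀ {n} → Matrix n n → (Y : Subset n) → Matrix (length (elems Y)) (length (elems Y))
principalSub A Y r c = A (List.lookup (elems Y) r) (List.lookup (elems Y) c)

detSub : ∀ {n} → Matrix n n → Subset n → GF4
detSub A Y = det (length (elems Y)) (principalSub A Y)

module Submission where

open import Defs
open import Algebra.Bundles using (CommutativeSemiring)
open import Algebra.Structures.Biased using (isCommutativeSemiringˡ)
open import Data.Nat using (ℕ; zero; suc)
open import Data.Fin using (Fin; zero; suc; punchIn; toℕ)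
open import Data.Fin.Properties as Fin using ()
open import Data.Fin.Subset using (Subset)
open import Data.List using (List; []; _∷_)
open import Data.List as List using ()
open import Data.List.Membership.Propositional using (_∈_)
open import Data.List.Relation.Unary.All as All using (all?)
open import Data.List.Relation.Unary.Any using (here; there)
open import Data.Product using (_,_)
open import Data.Sum using (_⊎_; inj₁; inj₂; map₂)
open import Level using (0ℓ)
open import Relation.Binary.Definitions using (DecidableEquality)
open import Relation.Binary.PropositionalEquality
  using (_≡_; refl; sym; trans; cong; cong₂; module ≡-Reasoning)
open import Relation.Binary.PropositionalEquality.Algebra using (isMagma)
open import Relation.Nullary using (Dec; map′)
open import Relation.Nullary.Decidable using (from-yes)
open import Relation.Unary using (Decidable)

-- Proof idea: inv is a field automorphism, so inv (det M) = det (inv M). If A is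
-- inv-symmetric then so is every principal submatrix B = A[Y], i.e. inv B = Bᵀ
-- (as -1 = 1), and det Bᵀ = det B. Hence det B is fixed by inv, so it lies in the
-- prime field {0, 1}. That det Bᵀ = det B follows by expanding along the first row
-- and then the first column: in characteristic 2 Laplace expansion carries no signs,
-- so the two orders of expansion visibly give the same double sum.

elements : List GF4
elements = O ∷ I ∷ ω ∷ ω² ∷ []

∈-elements : ∀ x → x ∈ elements
∈-elements O  = here refl
∈-elements I  = there (here refl)
∈-elements ω  = there (there (here refl))
∈-elements ω² = there (there (there (here refl)))

∀? : ∀ {p} {P : GF4 → Set p} → Decidable P → Dec (∀ x → P x)
∀? P? = map′ (λ ps x → All.lookup ps (∈-elements x))
             (λ ∀P → All.tabulate (λ {x} _ → ∀P x))
             (all? P? elements)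

toFin : GF4 → Fin 4
toFin O  = zero
toFin I  = suc zero
toFin ω  = suc (suc zero)
toFin ω² = suc (suc (suc zero))

fromFin : Fin 4 → GF4
fromFin zero                   = O
fromFin (suc zero)             = I
fromFin (suc (suc zero))       = ω
fromFin (suc (suc (suc zero))) = ω²

fromFin-toFin : ∀ x → fromFin (toFin x) ≡ x
fromFin-toFin O  = refl
fromFin-toFin I  = refl
fromFin-toFin ω  = refl
fromFin-toFin ω² = refl

toFin-injective : ∀ {x y} → toFin x ≡ toFin y → x ≡ y
toFin-injective {x} {y} p =
  trans (sym (fromFin-toFin x)) (trans (cong fromFin p) (fromFin-toFin y))

infix 4 _≟_
_≟_ : DecidableEquality GF4
x ≟ y = map′ toFin-injective (cong toFin) (toFin x Fin.≟ toFin y)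

+-assoc : ∀ x y z → (x + y) + z ≡ x + (y + z)
+-assoc = from-yes (∀? λ x → ∀? λ y → ∀? λ z → (x + y) + z ≟ x + (y + z))

+-comm : ∀ x y → x + y ≡ y + x
+-comm = from-yes (∀? λ x → ∀? λ y → x + y ≟ y + x)

+-identityʳ : ∀ x → x + O ≡ x
+-identityʳ = from-yes (∀? λ x → x + O ≟ x)

*-assoc : ∀ x y z → (x * y) * z ≡ x * (y * z)
*-assoc = from-yes (∀? λ x → ∀? λ y → ∀? λ z → (x * y) * z ≟ x * (y * z))

*-comm : ∀ x y → x * y ≡ y * x
*-comm = from-yes (∀? λ x → ∀? λ y → x * y ≟ y * x)

*-identityˡ : ∀ x → I * x ≡ x
*-identityˡ = from-yes (∀? λ x → I * x ≟ x)

*-identityʳ : ∀ x → x * I ≡ x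
*-identityʳ = from-yes (∀? λ x → x * I ≟ x)

*-distribʳ-+ : ∀ x y z → (y + z) * x ≡ y * x + z * x
*-distribʳ-+ = from-yes (∀? λ x → ∀? λ y → ∀? λ z → (y + z) * x ≟ y * x + z * x)

+-*-commutativeSemiring : CommutativeSemiring 0ℓ 0ℓ
+-*-commutativeSemiring = record
  { isCommutativeSemiring = isCommutativeSemiringˡ record
    { +-isCommutativeMonoid = record
      { isMonoid = record
        { isSemigroup = record { isMagma = isMagma _+_ ; assoc = +-assoc }
        ; identity    = (λ _ → refl) , +-identityʳ
        }
      ; comm = +-comm
      }
    ; *-isCommutativeMonoid = record
      { isMonoid = record
        { isSemigroup = record { isMagma = isMagma _*_ ; assoc = *-assoc }
        ; identity    = *-identityˡ , *-identityʳ
        }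
      ; comm = *-comm
      }
    ; distribʳ = *-distribʳ-+
    ; zeroˡ    = λ _ → refl
    }
  }

open CommutativeSemiring +-*-commutativeSemiring
  using (+-commutativeMonoid; semiring; *-commutativeSemigroup)
open import Algebra.Properties.CommutativeMonoid.Sum +-commutativeMonoid
  using (sum; sum-syntax; sum-cong-≗; ∑-comm)
open import Algebra.Properties.Semiring.Sum semiring using (*-distribˡ-sum)
open import Algebra.Properties.CommutativeSemigroup *-commutativeSemigroup
  using (x∙yz≈y∙xz)

inv-+ : ∀ x y → inv (x + y) ≡ inv x + inv y
inv-+ = from-yes (∀? λ x → ∀? λ y → inv (x + y) ≟ inv x + inv y)

inv-* : ∀ x y → inv (x * y) ≡ inv x * inv y
inv-* = from-yes (∀? λ x → ∀? λ y → inv (x * y) ≟ inv x * inv y)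

inv-sum : ∀ {k} (f : Fin k → GF4) → inv (sum f) ≡ sum (λ i → inv (f i))
inv-sum {zero}  f = refl
inv-sum {suc k} f = trans (inv-+ (f zero) _) (cong (inv (f zero) +_) (inv-sum (λ i → f (suc i))))

inv-fixed : ∀ x → inv x ≡ x → x ≡ O ⊎ x ≡ I
inv-fixed O  _ = inj₁ refl
inv-fixed I  _ = inj₂ refl
inv-fixed ω  ()
inv-fixed ω² ()

minor : ∀ {m n} → Matrix (suc m) (suc n) → Fin (suc m) → Fin (suc n) → Matrix m n
minor M i j r c = M (punchIn i r) (punchIn j c)

sumF≡sum : ∀ k (f : Fin k → GF4) → sumF k f ≡ sum f
sumF≡sum zero    f = refl
sumF≡sum (suc k) f = cong (f zero +_) (sumF≡sum k (λ i → f (suc i)))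

signed-id : ∀ j x → signed j x ≡ x
signed-id zero    x = refl
signed-id (suc j) x = signed-id j x

det-expand-row : ∀ k (M : Matrix (suc k) (suc k)) →
  det (suc k) M ≡ ∑[ j < suc k ] (M zero j * det k (minor M zero j))
det-expand-row k M = trans
  (sumF≡sum (suc k) (λ j → signed (toℕ j) (M zero j * det k (minor M zero j))))
  (sum-cong-≗ (λ j → signed-id (toℕ j) (M zero j * det k (minor M zero j))))

det-cong : ∀ k {M N : Matrix k k} → (∀ r c → M r c ≡ N r c) → det k M ≡ det k N
det-cong zero    M≗N = refl
det-cong (suc k) M≗N = sumF-cong (suc k) (λ j →
  cong (signed (toℕ j))
       (cong₂ _*_ (M≗N zero j) (det-cong k (λ r c → M≗N (suc r) (punchIn j c)))))
  where
  sumF-cong : ∀ k {f g : Fin k → GF4} → (∀ i → f i ≡ g i) → sumF k f ≡ sumF k g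
  sumF-cong zero    f≗g = refl
  sumF-cong (suc k) f≗g = cong₂ _+_ (f≗g zero) (sumF-cong k (λ i → f≗g (suc i)))

inv-det : ∀ k (M : Matrix k k) → inv (det k M) ≡ det k (invM M)
inv-det zero    M = refl
inv-det (suc k) M = begin
  inv (det (suc k) M)
    ≡⟨ cong inv (det-expand-row k M) ⟩
  inv (∑[ j < suc k ] (M zero j * det k (minor M zero j)))
    ≡⟨ inv-sum (λ j → M zero j * det k (minor M zero j)) ⟩
  ∑[ j < suc k ] inv (M zero j * det k (minor M zero j))
    ≡⟨ sum-cong-≗ (λ j → trans (inv-* (M zero j) _)
                                 (cong (inv (M zero j) *_) (inv-det k (minor M zero j)))) ⟩
  ∑[ j < suc k ] (inv (M zero j) * det k (invM (minor M zero j)))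
    ≡⟨ det-expand-row k (invM M) ⟨
  det (suc k) (invM M) ∎
  where open ≡-Reasoning

TransposeInvariant : ℕ → Set
TransposeInvariant k = ∀ (M : Matrix k k) → det k (transpose M) ≡ det k M

det-expand-column : ∀ {k} → TransposeInvariant k → TransposeInvariant (suc k) →
  ∀ M → det (suc k) M ≡ ∑[ i < suc k ] (M i zero * det k (minor M i zero))
det-expand-column {k} transp-k transp-suc-k M = begin
  det (suc k) M
    ≡⟨ transp-suc-k M ⟨
  det (suc k) (transpose M)
    ≡⟨ det-expand-row k (transpose M) ⟩
  ∑[ i < suc k ] (M i zero * det k (transpose (minor M i zero)))
    ≡⟨ sum-cong-≗ (λ i → cong (M i zero *_) (transp-k (minor M i zero))) ⟩
  ∑[ i < suc k ] (M i zero * det k (minor M i zero)) ∎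
  where open ≡-Reasoning

-- The part of the double expansion (first row, then first column) that avoids M₀₀.
offDiagonal : ∀ m → Matrix (suc (suc m)) (suc (suc m)) → GF4
offDiagonal m M = ∑[ j < suc m ] ∑[ i < suc m ]
  (M zero (suc j) * (M (suc i) zero * det m (minor (minor M zero zero) i j)))

det-expand-corner : ∀ {m} → TransposeInvariant m → TransposeInvariant (suc m) →
  ∀ M → det (suc (suc m)) M ≡ M zero zero * det (suc m) (minor M zero zero) + offDiagonal m M
det-expand-corner {m} transp-m transp-suc-m M =
  trans (det-expand-row (suc m) M) (cong (M zero zero * det (suc m) (minor M zero zero) +_)
    (sum-cong-≗ λ j → trans
      (cong (M zero (suc j) *_) (det-expand-column transp-m transp-suc-m (minor M zero (suc j))))
      (*-distribˡ-sum (M zero (suc j))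
        (λ i → M (suc i) zero * det m (minor (minor M zero zero) i j)))))

offDiagonal-transpose : ∀ {m} → TransposeInvariant m →
  ∀ M → offDiagonal m (transpose M) ≡ offDiagonal m M
offDiagonal-transpose {m} transp-m M = begin
  ∑[ j < suc m ] ∑[ i < suc m ] (M (suc j) zero * (M zero (suc i) * det m (transpose (N j i))))
    ≡⟨ sum-cong-≗ (λ j → sum-cong-≗ (λ i →
         cong (λ d → M (suc j) zero * (M zero (suc i) * d)) (transp-m (N j i)))) ⟩
  ∑[ j < suc m ] ∑[ i < suc m ] (M (suc j) zero * (M zero (suc i) * det m (N j i)))
    ≡⟨ ∑-comm (λ j i → M (suc j) zero * (M zero (suc i) * det m (N j i))) ⟩
  ∑[ i < suc m ] ∑[ j < suc m ] (M (suc j) zero * (M zero (suc i) * det m (N j i)))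
    ≡⟨ sum-cong-≗ (λ i → sum-cong-≗ (λ j →
         x∙yz≈y∙xz (M (suc j) zero) (M zero (suc i)) (det m (N j i)))) ⟩
  ∑[ i < suc m ] ∑[ j < suc m ] (M zero (suc i) * (M (suc j) zero * det m (N j i))) ∎
  where
  open ≡-Reasoning
  N : Fin (suc m) → Fin (suc m) → Matrix m m
  N = minor (minor M zero zero)

det-transpose : ∀ k → TransposeInvariant k
det-transpose zero          M = refl
det-transpose (suc zero)    M = refl
det-transpose (suc (suc m)) M = begin
  det (suc (suc m)) (transpose M)
    ≡⟨ det-expand-corner (det-transpose m) (det-transpose (suc m)) (transpose M) ⟩
  M zero zero * det (suc m) (transpose (minor M zero zero)) + offDiagonal m (transpose M)
    ≡⟨ cong₂ (λ d s → M zero zero * d + s)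
         (det-transpose (suc m) (minor M zero zero))
         (offDiagonal-transpose (det-transpose m) M) ⟩
  M zero zero * det (suc m) (minor M zero zero) + offDiagonal m M
    ≡⟨ det-expand-corner (det-transpose m) (det-transpose (suc m)) M ⟨
  det (suc (suc m)) M ∎
  where open ≡-Reasoning

principalSub-invSymmetric : ∀ {n} {A : Matrix n n} → InvSymmetric A →
  ∀ Y → InvSymmetric (principalSub A Y)
principalSub-invSymmetric A-sym Y r c = A-sym (List.lookup (elems Y) r) (List.lookup (elems Y) c)

inv-det-invSymmetric : ∀ {k} {M : Matrix k k} → InvSymmetric M → inv (det k M) ≡ det k M
inv-det-invSymmetric {k} {M} M-sym = begin
  inv (det k M)             ≡⟨ inv-det k M ⟩
  det k (invM M)            ≡⟨ det-cong k (λ r c → M-sym c r) ⟩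
  det k (transpose M)       ≡⟨ det-transpose k M ⟩
  det k M                   ∎
  where open ≡-Reasoning

theorem4 : (n : ℕ) (A : Matrix n n) → InvSymmetric A →
    (Y : Subset n) → detSub A Y ≡ O ⊎ (detSub A Y ≡ I ⊎ detSub A Y ≡ - I)
theorem4 _ A A-sym Y =
  map₂ inj₁ (inv-fixed (detSub A Y) (inv-det-invSymmetric (principalSub-invSymmetric A-sym Y)))
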